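{- Let $T$ be a finite rooted tree with node set $\mathcal V$, cost function $c:\mathcal V\to\mathbb R_{\ge0}$, integer budget $B\ge1$, and importance function $r:\mathcal V\to\mathbb R_{>0}$. For every nonempty hypernode $\mathbf v$, the output of the SEI algorithm started at $\mathbf v$ satisfies \[\mathbb E\big[C_{\mathrm{SEI}}(T_{\mathbf v})\big]=\frac{\mathrm{Cost}(T_{\mathbf v})}{|\mathbf v|}.\]
   Context: For a node $v$, $S(v)$ is its set of children and $T_v$ is the subtree rooted at $v$, with $\mathrm{Cost}(T_v)=\sum_{u\in T_v}c(u)$. A hypernode is a set of distinct nodes of $T$ all at the same depth. For a set of nodes $\mathbf v$: $c(\mathbf v)=\sum_{v\in\mathbf v}c(v)$, $r(\mathbf v)=\sum_{v\in\mathbf v}r(v)$, $S(\mathbf v)=\bigcup_{v\in\mathbf v}S(v)$, $T_{\mathbf v}=\bigcup_{v\in\mathbf v}T_v$, and $\mathrm{Cost}(T_{\mathbf v})=\sum_{v\in\mathbf v}\mathrm{Cost}(T_v)$. The hyperchildren of $\mathbf v$ are $H(\mathbf v)=\{\mathbf w\subseteq S(\mathbf v): |\mathbf w|=\min(B,|S(\mathbf v)|)\}$. SEI algorithm started at $\mathbf v$: set $k=0$, $\mathbf x_0=\mathbf v$, $D=1$, $C=c(\mathbf x_0)/|\mathbf x_0|$. Repeat: if $S(\mathbf x_k)=\emptyset$, stop and output $C_{\mathrm{SEI}}(T_{\mathbf v})=C$. Otherwise choose $\mathbf x_{k+1}\in H(\mathbf x_k)$ by first choosing $x\in S(\mathbf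 x_k)$ with probability $r(x)/r(S(\mathbf x_k))$ and then choosing the remaining $\min(B,|S(\mathbf x_k)|)-1$ elements of $\mathbf x_{k+1}$ as a uniformly random subset of $S(\mathbf x_k)\setminus\{x\}$ (with fresh randomness at each step); set $D_k=\frac{|\mathbf x_{k+1}|}{|\mathbf x_k|}\cdot\frac{r(S(\mathbf x_k))}{r(\mathbf x_{k+1})}$, $D\leftarrow D\cdot D_k$, $C\leftarrow C+\frac{c(\mathbf x_{k+1})}{|\mathbf x_{k+1}|}D$, and $k\leftarrow k+1$. The estimate of $\mathrm{Cost}(T_{\mathbf v})$ is $|\mathbf v|C_{\mathrm{SEI}}(T_{\mathbf v})$.
   Formalization: The cost function c and the importance function r take values in the nonnegative and positive rationals, respectively, rather than in $\mathbb R_{\ge0}$ and $\mathbb R_{>0}$. -}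

module Defs where

open import Data.Nat as ℕ using (ℕ; zero; suc)
open import Data.Integer using (+_)
open import Data.Rational as ℚ using (ℚ; 0ℚ; 1ℚ; _+_; _*_; _÷_; _≤_; _<_; ≢-nonZero)
open import Data.Rational.Properties using (_≟_)
open import Data.List as L using (List; []; _∷_; [_]; length; map; concatMap; _++_; foldr; lookup)
open import Data.Fin using (Fin; toℕ)
open import Data.Product using (_×_; _,_; proj₁; proj₂)
open import Relation.Nullary using (yes; no)

ℕ→ℚ : ℕ → ℚ
ℕ→ℚ n = (+ n) ℚ./ 1

-- total division; the fallback value 0 for a zero denominator is never
-- used in the theorem (all denominators there are positive)
_/ᵗ_ : ℚ → ℚ → ℚ
p /ᵗ q with q ≟ 0ℚ
... | yes _  = 0ℚ
... | no q≢0 = _÷_ p q {{≢-nonZero q≢0}}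

sumℚ : List ℚ → ℚ
sumℚ = foldr _+_ 0ℚ

data Tree : Set where
  node : (c r : ℚ) → (children : List Tree) → Tree

cost : Tree → ℚ
cost (node c _ _) = c

imp : Tree → ℚ
imp (node _ r _) = r

kids : Tree → List Tree
kids (node _ _ ts) = ts

mutual
  treeCost : Tree → ℚ
  treeCost (node c _ ts) = c + forestCost ts

  forestCost : List Tree → ℚ
  forestCost []       = 0ℚ
  forestCost (t ∷ ts) = treeCost t + forestCost ts

-- height (number of levels) of a forest, used only as termination fuel
mutual
  height : Tree → ℕ
  height (node _ _ ts) = suc (heightF ts)

  heightF : List Tree → ℕ
  heightF []       = 0
  heightF (t ∷ ts) = height t ℕ.⊔ heightF ts

-- Nodes of T are addressed by paths from the root (lists of child indices).
-- At T p u : the node at path p in T exists and its subtree T_p is u.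
data At : Tree → List ℕ → Tree → Set where
  here  : ∀ {t} → At t [] t
  there : ∀ {c r ts p u} (i : Fin (length ts)) →
          At (lookup ts i) p u → At (node c r ts) (toℕ i ∷ p) u

WellLabelled : Tree → Set
WellLabelled T = ∀ p u → At T p u → (0ℚ ≤ cost u) × (0ℚ < imp u)

-- Sets of nodes (represented as duplicate-free lists of their subtrees;
-- distinct list positions are distinct nodes)

cS : List Tree → ℚ
cS xs = sumℚ (map cost xs)

rS : List Tree → ℚ
rS xs = sumℚ (map imp xs)

childrenS : List Tree → List Tree
childrenS = concatMap kids

-- Finite probability distributions: lists of (probability, outcome)

Dist : Set → Set
Dist A = List (ℚ × A)

scale : ∀ {A} → ℚ → Dist A → Dist A
scale q = map (λ pa → (q * proj₁ pa , proj₂ pa))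

𝔼 : Dist ℚ → ℚ
𝔼 d = sumℚ (map (λ pa → proj₁ pa * proj₂ pa) d)

picks : ∀ {A : Set} → List A → List (A × List A)
picks []       = []
picks (x ∷ xs) = (x , xs) ∷ map (λ yr → (proj₁ yr , x ∷ proj₂ yr)) (picks xs)

combs : ∀ {A : Set} → ℕ → List A → List (List A)
combs zero    _        = [ [] ]
combs (suc k) []       = []
combs (suc k) (x ∷ xs) = map (x ∷_) (combs k xs) ++ combs (suc k) xs

-- The SEI algorithm, as the exact distribution of its output C.
-- State: current hypernode x = 𝐱_k, accumulated D and C.
-- The fuel argument only guarantees termination; it is started at the
-- height of the initial forest, which always suffices.

module _ (B : ℕ) where

  mutual
    seiRun : ℕ → List Tree → ℚ → ℚ → Dist ℚ
    seiRun zero    x D C = [ (1ℚ , C) ]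
    seiRun (suc f) x D C = seiStep f x (childrenS x) D C

    seiStep : ℕ → List Tree → List Tree → ℚ → ℚ → Dist ℚ
    seiStep f x []          D C = [ (1ℚ , C) ]
    seiStep f x S@(_ ∷ _)   D C =
      concatMap
        (λ yrest →
          let y    = proj₁ yrest
              rest = proj₂ yrest
              m    = B ℕ.⊓ length S
              ws   = combs (m ℕ.∸ 1) rest
              py   = imp y /ᵗ rS S                    -- P(first choice = y)
              pw   = 1ℚ /ᵗ ℕ→ℚ (length ws)           -- uniform remaining subset
          in concatMap
               (λ w →
                 let x'  = y ∷ w
                     Dk  = (ℕ→ℚ (length x') /ᵗ ℕ→ℚ (length x)) * (rS S /ᵗ rS x')
                     D'  = D * Dk
                     C'  = C + (cS x' /ᵗ ℕ→ℚ (length x')) * D'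
                 in scale (py * pw) (seiRun f x' D' C'))
               ws)
        (picks S)

  SEI : List Tree → Dist ℚ
  SEI vs = seiRun (heightF vs) vs 1ℚ (cS vs /ᵗ ℕ→ℚ (length vs))

-- Induction on the height gives the invariant: started at 𝐱 with accumulators C and D, SEI
-- outputs C + D · Cost(T_S)/|𝐱| in expectation, where S = S(𝐱) and R = r(S).  For one step to
-- 𝐱′ = y ∷ w, the new increment c(𝐱′)/|𝐱′| · D′ and the inductive tail D′ · Cost(T_{S(𝐱′)})/|𝐱′|
-- combine into D · (R/|𝐱|) · Cost(T_𝐱′)/r(𝐱′).  Averaging over y (probability r(y)/R) and w
-- (uniform among the k-subsets of S ∖ {y}), every (k+1)-subset X of S is met once per element
-- y ∈ X with weight r(y); these weights add up to r(X) and cancel the denominator.  What is left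
-- is Σ_X Cost(T_X), and every node of S lies in as many X as there are choices of w.

module Submission where

open import Defs
open import Data.Nat using (ℕ; _≤_)
open import Data.List using (List; []; length)
open import Data.List.Relation.Unary.All using (All)
open import Data.List.Relation.Unary.Unique.Propositional using (Unique)
open import Data.List.Relation.Binary.Pointwise using (Pointwise)
open import Relation.Binary.PropositionalEquality using (_≡_; _≢_)

open import Algebra.Bundles using (CommutativeMonoid)
open import Data.Empty using (⊥-elim)
open import Data.Fin as Fin using (Fin)
open import Data.Integer as ℤ using (1ℤ)
import Data.Integer.Tactic.RingSolver as ℤ
open import Data.List as List using (_∷_; [_]; map; concatMap; _++_)
import Data.List.Properties as List
open import Data.List.Relation.Binary.Permutation.Propositional
  using (_↭_; ↭-refl; ↭-sym; ↭-prep; ↭-swap; ↭-trans; ↭⇒↭ₛ)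
open import Data.List.Relation.Binary.Permutation.Propositional.Properties
  using (map⁺; All-resp-↭; ↭-length)
import Data.List.Relation.Binary.Permutation.Setoid.Properties as Setoid↭
open import Data.List.Relation.Binary.Pointwise using ([]; _∷_; Pointwise-length)
open import Data.List.Relation.Unary.All as All using ([]; _∷_)
import Data.List.Relation.Unary.All.Properties as All
open import Data.Nat as ℕ using (zero; suc; pred; _⊓_; _∸_; z≤n; s≤s)
open import Data.Nat.Combinatorics using (nCk+nC[k+1]≡[n+1]C[k+1]) renaming (_C_ to _choose_)
import Data.Nat.Properties as ℕ
open import Data.Product using (_×_; _,_; proj₁; proj₂; uncurry)
open import Data.Rational as ℚ using (ℚ; 0ℚ; 1ℚ; _+_; _*_; _<_)
import Data.Rational.Properties as ℚ
import Data.Rational.Unnormalised as ℚᵘ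
import Data.Rational.Unnormalised.Properties as ℚᵘ
open import Function using (_∘_)
open import Relation.Binary.PropositionalEquality
  using (≢-sym; refl; sym; trans; cong; cong₂; setoid; module ≡-Reasoning)
open import Relation.Nullary using (yes; no)
open import Relation.Nullary.Decidable using (dec⇒maybe)
open import Tactic.RingSolver using (solve-∀)
open import Tactic.RingSolver.Core.AlmostCommutativeRing using (AlmostCommutativeRing; fromCommutativeRing)

open import Algebra.Properties.CommutativeSemigroup
  (CommutativeMonoid.commutativeSemigroup ℚ.+-0-commutativeMonoid)
  using () renaming (interchange to +-interchange)

ℚ-ring : AlmostCommutativeRing _ _
ℚ-ring = fromCommutativeRing ℚ.+-*-commutativeRing (dec⇒maybe ∘ (0ℚ ℚ.≟_))

ℕ→ℚ-suc : ∀ n → ℕ→ℚ (suc n) ≡ 1ℚ + ℕ→ℚ n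
ℕ→ℚ-suc n = ℚ.toℚᵘ-injective (begin-equality
  ℚ.toℚᵘ (ℕ→ℚ (suc n))            ≃⟨ ℚ.toℚᵘ-fromℚᵘ (ℚᵘ.mkℚᵘ (ℤ.+ suc n) 0) ⟩
  ℚᵘ.mkℚᵘ (ℤ.+ suc n) 0            ≃⟨ ℚᵘ.*≡* (unit-denominators (ℤ.+ n)) ⟩
  ℚᵘ.1ℚᵘ ℚᵘ.+ ℚᵘ.mkℚᵘ (ℤ.+ n) 0    ≃⟨ ℚᵘ.+-congʳ ℚᵘ.1ℚᵘ (ℚᵘ.≃-sym (ℚ.toℚᵘ-fromℚᵘ (ℚᵘ.mkℚᵘ (ℤ.+ n) 0))) ⟩
  ℚ.toℚᵘ 1ℚ ℚᵘ.+ ℚ.toℚᵘ (ℕ→ℚ n)   ≃⟨ ℚ.toℚᵘ-homo-+ 1ℚ (ℕ→ℚ n) ⟨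
  ℚ.toℚᵘ (1ℚ + ℕ→ℚ n)             ∎)
  where
  open ℚᵘ.≤-Reasoning
  unit-denominators : ∀ b → (1ℤ ℤ.+ b) ℤ.* 1ℤ ≡ (1ℤ ℤ.* 1ℤ ℤ.+ b ℤ.* 1ℤ) ℤ.* 1ℤ
  unit-denominators = ℤ.solve-∀

ℕ→ℚ-suc-pos : ∀ n → 0ℚ < ℕ→ℚ (suc n)
ℕ→ℚ-suc-pos n = ℚ.positive⁻¹ _ {{ℚ.normalize-pos (suc n) 1}}

>0⇒≢0 : ∀ {q} → 0ℚ < q → q ≢ 0ℚ
>0⇒≢0 q>0 = ≢-sym (ℚ.<⇒≢ q>0)

ℕ→ℚ-≢0 : ∀ {n} → 0 ℕ.< n → ℕ→ℚ n ≢ 0ℚ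
ℕ→ℚ-≢0 {suc n} _ = >0⇒≢0 (ℕ→ℚ-suc-pos n)

inv : ℚ → ℚ
inv q = 1ℚ /ᵗ q

-- Also for q = 0, where both sides are 0.
/ᵗ-≡-*inv : ∀ p q → p /ᵗ q ≡ p * inv q
/ᵗ-≡-*inv p q with q ℚ.≟ 0ℚ
... | yes _ = sym (ℚ.*-zeroʳ p)
... | no _  = cong (p *_) (sym (ℚ.*-identityˡ _))

*-inv : ∀ {q} → q ≢ 0ℚ → q * inv q ≡ 1ℚ
*-inv {q} q≢0 with q ℚ.≟ 0ℚ
... | yes q≡0 = ⊥-elim (q≢0 q≡0)
... | no q≢0  = trans (cong (q *_) (ℚ.*-identityˡ _)) (ℚ.*-inverseʳ q {{ℚ.≢-nonZero q≢0}})

*-unitʳ : ∀ {u} → u ≡ 1ℚ → ∀ a → a * u ≡ a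
*-unitʳ u≡1 a = trans (cong (a *_) u≡1) (ℚ.*-identityʳ a)

*-/ᵗ-cancel : ∀ p {q} → q ≢ 0ℚ → q * (p /ᵗ q) ≡ p
*-/ᵗ-cancel p {q} q≢0 = begin
  q * (p /ᵗ q)     ≡⟨ cong (q *_) (/ᵗ-≡-*inv p q) ⟩
  q * (p * inv q)  ≡⟨ ℚ.*-comm q (p * inv q) ⟩
  p * inv q * q    ≡⟨ ℚ.*-assoc p (inv q) q ⟩
  p * (inv q * q)  ≡⟨ cong (p *_) (trans (ℚ.*-comm (inv q) q) (*-inv q≢0)) ⟩
  p * 1ℚ           ≡⟨ ℚ.*-identityʳ p ⟩
  p                ∎
  where open ≡-Reasoning

c+d*[0/q]≡c : ∀ c d q → c + d * (0ℚ /ᵗ q) ≡ c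
c+d*[0/q]≡c c d q = begin
  c + d * (0ℚ /ᵗ q)  ≡⟨ cong (λ z → c + d * z) (trans (/ᵗ-≡-*inv 0ℚ q) (ℚ.*-zeroˡ (inv q))) ⟩
  c + d * 0ℚ         ≡⟨ cong (c +_) (ℚ.*-zeroʳ d) ⟩
  c + 0ℚ             ≡⟨ ℚ.+-identityʳ c ⟩
  c                  ∎
  where open ≡-Reasoning

∑ : {A : Set} → List A → (A → ℚ) → ℚ
∑ xs f = sumℚ (map f xs)

infix 5 ∑
syntax ∑ xs (λ x → e) = ∑[ x ∈ xs ] e

module _ {A : Set} where

  ∑-++ : ∀ (xs ys : List A) f → ∑ (xs ++ ys) f ≡ ∑ xs f + ∑ ys f
  ∑-++ []       ys f = sym (ℚ.+-identityˡ _)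
  ∑-++ (x ∷ xs) ys f = trans (cong (f x +_) (∑-++ xs ys f)) (sym (ℚ.+-assoc (f x) _ _))

  ∑-map : ∀ {B : Set} (g : A → B) xs f → ∑ (map g xs) f ≡ ∑ xs (f ∘ g)
  ∑-map g []       f = refl
  ∑-map g (x ∷ xs) f = cong (f (g x) +_) (∑-map g xs f)

  ∑-congᴬ : ∀ {xs : List A} {f g} → All (λ x → f x ≡ g x) xs → ∑ xs f ≡ ∑ xs g
  ∑-congᴬ []            = refl
  ∑-congᴬ (fx≡gx ∷ eqs) = cong₂ _+_ fx≡gx (∑-congᴬ eqs)

  ∑-cong : ∀ (xs : List A) {f g} → (∀ x → f x ≡ g x) → ∑ xs f ≡ ∑ xs g
  ∑-cong xs f≗g = ∑-congᴬ (All.universal f≗g xs)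

  ∑-+ : ∀ (xs : List A) f g → ∑[ x ∈ xs ] (f x + g x) ≡ ∑ xs f + ∑ xs g
  ∑-+ []       f g = sym (ℚ.+-identityˡ 0ℚ)
  ∑-+ (x ∷ xs) f g = trans (cong (f x + g x +_) (∑-+ xs f g)) (+-interchange (f x) (g x) _ _)

  ∑-*ˡ : ∀ (xs : List A) a f → ∑[ x ∈ xs ] (a * f x) ≡ a * ∑ xs f
  ∑-*ˡ []       a f = sym (ℚ.*-zeroʳ a)
  ∑-*ˡ (x ∷ xs) a f = trans (cong (a * f x +_) (∑-*ˡ xs a f)) (sym (ℚ.*-distribˡ-+ a (f x) _))

  ∑-*ʳ : ∀ (xs : List A) f a → ∑[ x ∈ xs ] (f x * a) ≡ ∑ xs f * a
  ∑-*ʳ []       f a = sym (ℚ.*-zeroˡ a)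
  ∑-*ʳ (x ∷ xs) f a = trans (cong (f x * a +_) (∑-*ʳ xs f a)) (sym (ℚ.*-distribʳ-+ a (f x) _))

  ∑-linear : ∀ (xs : List A) a b f g → ∑[ x ∈ xs ] (a * f x + b * g x) ≡ a * ∑ xs f + b * ∑ xs g
  ∑-linear xs a b f g = trans (∑-+ xs _ _) (cong₂ _+_ (∑-*ˡ xs a f) (∑-*ˡ xs b g))

  ∑-const : ∀ (xs : List A) a → ∑[ _ ∈ xs ] a ≡ ℕ→ℚ (length xs) * a
  ∑-const []       a = sym (ℚ.*-zeroˡ a)
  ∑-const (x ∷ xs) a = begin
    a + (∑[ _ ∈ xs ] a)           ≡⟨ cong₂ _+_ (sym (ℚ.*-identityˡ a)) (∑-const xs a) ⟩
    1ℚ * a + ℕ→ℚ (length xs) * a  ≡⟨ ℚ.*-distribʳ-+ a 1ℚ (ℕ→ℚ (length xs)) ⟨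
    (1ℚ + ℕ→ℚ (length xs)) * a    ≡⟨ cong (_* a) (ℕ→ℚ-suc (length xs)) ⟨
    ℕ→ℚ (suc (length xs)) * a     ∎
    where open ≡-Reasoning

  ∑-↭ : ∀ {xs ys : List A} f → xs ↭ ys → ∑ xs f ≡ ∑ ys f
  ∑-↭ f xs↭ys = Setoid↭.foldr-commMonoid (setoid ℚ) ℚ.+-0-isCommutativeMonoid (↭⇒↭ₛ (map⁺ f xs↭ys))

  ∑-nonneg : ∀ {xs : List A} {f} → All (λ x → 0ℚ ℚ.≤ f x) xs → 0ℚ ℚ.≤ ∑ xs f
  ∑-nonneg []             = ℚ.≤-refl
  ∑-nonneg (fx≥0 ∷ fxs≥0) = ℚ.+-mono-≤ fx≥0 (∑-nonneg fxs≥0)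

  ∑-pos : ∀ {x} {xs : List A} {f} → All (λ x → 0ℚ < f x) (x ∷ xs) → 0ℚ < ∑ (x ∷ xs) f
  ∑-pos (fx>0 ∷ fxs>0) = ℚ.+-mono-<-≤ fx>0 (∑-nonneg (All.map ℚ.<⇒≤ fxs>0))

  ∑-*-ratio : ∀ {X : List A} g h → All (λ x → 0ℚ < h x) X → ∑ X h * (∑ X g /ᵗ ∑ X h) ≡ ∑ X g
  ∑-*-ratio {[]}    g h []  = ℚ.*-zeroˡ (0ℚ /ᵗ 0ℚ)
  ∑-*-ratio {y ∷ w} g h h>0 = *-/ᵗ-cancel (∑ (y ∷ w) g) (>0⇒≢0 (∑-pos h>0))

𝔼-dirac : ∀ C → 𝔼 [ (1ℚ , C) ] ≡ C
𝔼-dirac C = trans (ℚ.+-identityʳ (1ℚ * C)) (ℚ.*-identityˡ C)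

𝔼-concatMap : ∀ {A : Set} (g : A → Dist ℚ) xs → 𝔼 (concatMap g xs) ≡ ∑[ x ∈ xs ] 𝔼 (g x)
𝔼-concatMap g []       = refl
𝔼-concatMap g (x ∷ xs) = trans (∑-++ (g x) (concatMap g xs) _) (cong (𝔼 (g x) +_) (𝔼-concatMap g xs))

𝔼-scale : ∀ q d → 𝔼 (scale q d) ≡ q * 𝔼 d
𝔼-scale q d = begin
  𝔼 (scale q d)                          ≡⟨ ∑-map _ d _ ⟩
  ∑[ pa ∈ d ] (q * proj₁ pa) * proj₂ pa  ≡⟨ ∑-cong d (λ pa → ℚ.*-assoc q (proj₁ pa) (proj₂ pa)) ⟩
  ∑[ pa ∈ d ] q * (proj₁ pa * proj₂ pa)  ≡⟨ ∑-*ˡ d q _ ⟩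
  q * 𝔼 d                                ∎
  where open ≡-Reasoning

k≤n⇒0<nCk : ∀ {n k} → k ≤ n → 0 ℕ.< n choose k
k≤n⇒0<nCk z≤n                        = s≤s z≤n
k≤n⇒0<nCk {suc n} {suc k} (s≤s k≤n) = ℕ.≤-trans (k≤n⇒0<nCk k≤n)
  (ℕ.≤-trans (ℕ.m≤m+n (n choose k) (n choose suc k)) (ℕ.≤-reflexive (nCk+nC[k+1]≡[n+1]C[k+1] n k)))

module _ {A : Set} where

  picks-↭ : ∀ (xs : List A) → All (λ p → proj₁ p ∷ proj₂ p ↭ xs) (picks xs)
  picks-↭ []       = []
  picks-↭ (x ∷ xs) =
    ↭-refl ∷ All.map⁺ (All.map (λ ↭xs → ↭-trans (↭-swap _ x ↭-refl) (↭-prep x ↭xs)) (picks-↭ xs))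

  map-proj₁-picks : ∀ (xs : List A) → map proj₁ (picks xs) ≡ xs
  map-proj₁-picks []       = refl
  map-proj₁-picks (x ∷ xs) = cong (x ∷_) (trans (sym (List.map-∘ (picks xs))) (map-proj₁-picks xs))

  ∑-picks-proj₁ : ∀ (xs : List A) g → ∑[ p ∈ picks xs ] g (proj₁ p) ≡ ∑ xs g
  ∑-picks-proj₁ xs g = trans (sym (∑-map proj₁ (picks xs) g)) (cong (λ ys → ∑ ys g) (map-proj₁-picks xs))

  All-combs : ∀ {P : A → Set} k {xs} → All P xs → All (All P) (combs k xs)
  All-combs zero    _          = [] ∷ []
  All-combs (suc k) []         = []
  All-combs (suc k) (px ∷ pxs) =
    All.++⁺ (All.map⁺ (All.map (px ∷_) (All-combs k pxs))) (All-combs (suc k) pxs)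

  length-combs : ∀ k (xs : List A) → length (combs k xs) ≡ length xs choose k
  length-combs zero    xs       = refl
  length-combs (suc k) []       = refl
  length-combs (suc k) (x ∷ xs) = begin
    length (map (x ∷_) (combs k xs) ++ combs (suc k) xs)
      ≡⟨ List.length-++ (map (x ∷_) (combs k xs)) ⟩
    length (map (x ∷_) (combs k xs)) ℕ.+ length (combs (suc k) xs)
      ≡⟨ cong₂ ℕ._+_ (trans (List.length-map (x ∷_) (combs k xs)) (length-combs k xs))
                     (length-combs (suc k) xs) ⟩
    length xs choose k ℕ.+ length xs choose suc k
      ≡⟨ nCk+nC[k+1]≡[n+1]C[k+1] (length xs) k ⟩
    suc (length xs) choose suc k ∎
    where open ≡-Reasoning

  length-combs-remainder : ∀ k {y rest} {xs : List A} → y ∷ rest ↭ xs →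
                           length (combs k rest) ≡ pred (length xs) choose k
  length-combs-remainder k {rest = rest} ↭xs =
    trans (length-combs k rest) (cong (λ n → pred n choose k) (↭-length ↭xs))

  -- Choosing y and then a k-subset w of the rest is choosing a (k+1)-subset X and then y ∈ X.
  ∑-picks-combs : ∀ k (xs : List A) (F : A → List A → ℚ) →
    ∑[ p ∈ picks xs ] ∑ (combs k (proj₂ p)) (F (proj₁ p)) ≡ ∑[ X ∈ combs (suc k) xs ] ∑ (picks X) (uncurry F)
  ∑-picks-combs k []       F = refl
  ∑-picks-combs k (x ∷ xs) F = begin
    ∑ (combs k xs) (F x) + ∑ (map shift (picks xs)) (λ p → ∑ (combs k (proj₂ p)) (F (proj₁ p)))
      ≡⟨ cong (∑ (combs k xs) (F x) +_) (trans (∑-map shift (picks xs) _) (remainders-with-x k)) ⟩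
    ∑ (combs k xs) (F x) + (M k + ∑ (combs (suc k) xs) G)
      ≡⟨ ℚ.+-assoc (∑ (combs k xs) (F x)) (M k) _ ⟨
    ∑ (combs k xs) (F x) + M k + ∑ (combs (suc k) xs) G
      ≡⟨ cong (_+ ∑ (combs (suc k) xs) G) subsets-with-x ⟨
    ∑ (map (x ∷_) (combs k xs)) G + ∑ (combs (suc k) xs) G
      ≡⟨ ∑-++ (map (x ∷_) (combs k xs)) (combs (suc k) xs) G ⟨
    ∑ (combs (suc k) (x ∷ xs)) G ∎
    where
    open ≡-Reasoning
    shift : A × List A → A × List A
    shift (y , rest) = (y , x ∷ rest)
    G : List A → ℚ
    G X = ∑ (picks X) (uncurry F)
    F′ : A → List A → ℚ
    F′ y w = F y (x ∷ w)
    M : ℕ → ℚ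
    M k = ∑[ X ∈ combs k xs ] ∑ (picks X) (uncurry F′)
    subsets-with-x : ∑ (map (x ∷_) (combs k xs)) G ≡ ∑ (combs k xs) (F x) + M k
    subsets-with-x = begin
      ∑ (map (x ∷_) (combs k xs)) G
        ≡⟨ ∑-map (x ∷_) (combs k xs) G ⟩
      ∑[ X ∈ combs k xs ] G (x ∷ X)
        ≡⟨ ∑-cong (combs k xs) (λ X → cong (F x X +_) (∑-map shift (picks X) (uncurry F))) ⟩
      ∑[ X ∈ combs k xs ] (F x X + ∑ (picks X) (uncurry F′))
        ≡⟨ ∑-+ (combs k xs) (F x) _ ⟩
      ∑ (combs k xs) (F x) + M k ∎
    remainders-with-x : ∀ k →
      ∑[ p ∈ picks xs ] ∑ (combs k (x ∷ proj₂ p)) (F (proj₁ p)) ≡ M k + ∑ (combs (suc k) xs) G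
    remainders-with-x zero    = trans (∑-picks-combs zero xs F) (sym (ℚ.+-identityˡ _))
    remainders-with-x (suc k) = begin
      ∑[ p ∈ picks xs ] ∑ (combs (suc k) (x ∷ proj₂ p)) (F (proj₁ p))
        ≡⟨ ∑-cong (picks xs) (λ p → trans (∑-++ (map (x ∷_) (combs k (proj₂ p))) _ _)
                                          (cong (_+ _) (∑-map (x ∷_) (combs k (proj₂ p)) _))) ⟩
      ∑[ p ∈ picks xs ] (∑ (combs k (proj₂ p)) (F′ (proj₁ p)) + ∑ (combs (suc k) (proj₂ p)) (F (proj₁ p)))
        ≡⟨ ∑-+ (picks xs) _ _ ⟩
      (∑[ p ∈ picks xs ] ∑ (combs k (proj₂ p)) (F′ (proj₁ p)))
        + (∑[ p ∈ picks xs ] ∑ (combs (suc k) (proj₂ p)) (F (proj₁ p)))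
        ≡⟨ cong₂ _+_ (∑-picks-combs k xs F′) (∑-picks-combs (suc k) xs F) ⟩
      M (suc k) + ∑ (combs (suc (suc k)) xs) G ∎

  ∑-picks-combs-head : ∀ k (xs : List A) g →
    ∑[ p ∈ picks xs ] ∑[ w ∈ combs k (proj₂ p) ] g (proj₁ p) ≡ ℕ→ℚ (pred (length xs) choose k) * ∑ xs g
  ∑-picks-combs-head k xs g = begin
    ∑[ p ∈ picks xs ] ∑[ w ∈ combs k (proj₂ p) ] g (proj₁ p)  ≡⟨ ∑-congᴬ (All.map count (picks-↭ xs)) ⟩
    ∑[ p ∈ picks xs ] N * g (proj₁ p)                         ≡⟨ ∑-*ˡ (picks xs) N (g ∘ proj₁) ⟩
    N * (∑[ p ∈ picks xs ] g (proj₁ p))                       ≡⟨ cong (N *_) (∑-picks-proj₁ xs g) ⟩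
    N * ∑ xs g                                                ∎
    where
    open ≡-Reasoning
    N = ℕ→ℚ (pred (length xs) choose k)
    count : ∀ {p} → proj₁ p ∷ proj₂ p ↭ xs → ∑[ w ∈ combs k (proj₂ p) ] g (proj₁ p) ≡ N * g (proj₁ p)
    count {y , rest} ↭xs =
      trans (∑-const (combs k rest) (g y)) (cong (λ n → ℕ→ℚ n * g y) (length-combs-remainder k ↭xs))

  ∑-combs-∑ : ∀ k (xs : List A) g →
    ∑[ X ∈ combs (suc k) xs ] ∑ X g ≡ ℕ→ℚ (pred (length xs) choose k) * ∑ xs g
  ∑-combs-∑ k xs g = begin
    ∑[ X ∈ combs (suc k) xs ] ∑ X g
      ≡⟨ ∑-cong (combs (suc k) xs) (λ X → ∑-picks-proj₁ X g) ⟨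
    ∑[ X ∈ combs (suc k) xs ] ∑ (picks X) (uncurry λ y _ → g y)
      ≡⟨ ∑-picks-combs k xs (λ y _ → g y) ⟨
    ∑[ p ∈ picks xs ] ∑[ w ∈ combs k (proj₂ p) ] g (proj₁ p)
      ≡⟨ ∑-picks-combs-head k xs g ⟩
    ℕ→ℚ (pred (length xs) choose k) * ∑ xs g ∎
    where open ≡-Reasoning

  ∑-picks-combs-ratio : ∀ k (xs : List A) g h → All (λ x → 0ℚ < h x) xs →
    ∑[ p ∈ picks xs ] ∑[ w ∈ combs k (proj₂ p) ] h (proj₁ p) * (∑ (proj₁ p ∷ w) g /ᵗ ∑ (proj₁ p ∷ w) h)
    ≡ ℕ→ℚ (pred (length xs) choose k) * ∑ xs g
  ∑-picks-combs-ratio k xs g h h>0 = begin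
    ∑[ p ∈ picks xs ] ∑[ w ∈ combs k (proj₂ p) ] h (proj₁ p) * ratio (proj₁ p ∷ w)
      ≡⟨ ∑-picks-combs k xs (λ y w → h y * ratio (y ∷ w)) ⟩
    ∑[ X ∈ combs (suc k) xs ] ∑[ p ∈ picks X ] h (proj₁ p) * ratio (proj₁ p ∷ proj₂ p)
      ≡⟨ ∑-cong (combs (suc k) xs) (λ X → ∑-congᴬ (All.map (cong (h _ *_) ∘ ratio-↭) (picks-↭ X))) ⟩
    ∑[ X ∈ combs (suc k) xs ] ∑[ p ∈ picks X ] h (proj₁ p) * ratio X
      ≡⟨ ∑-cong (combs (suc k) xs) (λ X → trans (∑-*ʳ (picks X) (h ∘ proj₁) (ratio X))
                                                (cong (_* ratio X) (∑-picks-proj₁ X h))) ⟩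
    ∑[ X ∈ combs (suc k) xs ] ∑ X h * ratio X
      ≡⟨ ∑-congᴬ (All.map (∑-*-ratio g h) (All-combs (suc k) h>0)) ⟩
    ∑[ X ∈ combs (suc k) xs ] ∑ X g
      ≡⟨ ∑-combs-∑ k xs g ⟩
    ℕ→ℚ (pred (length xs) choose k) * ∑ xs g ∎
    where
    open ≡-Reasoning
    ratio : List A → ℚ
    ratio X = ∑ X g /ᵗ ∑ X h
    ratio-↭ : ∀ {X Y} → X ↭ Y → ratio X ≡ ratio Y
    ratio-↭ X↭Y = cong₂ _/ᵗ_ (∑-↭ g X↭Y) (∑-↭ h X↭Y)

-- The step 𝐱 ↦ 𝐱′ in the paper's notation: m = |𝐱′|, N = |𝐱|, R = r(S(𝐱)), ρ = r(𝐱′),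
-- c = c(𝐱′), F = Cost(T_{S(𝐱′)}).
sei-update : ∀ C D c F R ρ {m} N → m ≢ 0ℚ →
  let D′ = D * ((m /ᵗ N) * (R /ᵗ ρ)) in
  (C + (c /ᵗ m) * D′) + D′ * (F /ᵗ m) ≡ C + D * (R /ᵗ N) * ((c + F) /ᵗ ρ)
sei-update C D c F R ρ {m} N m≢0
  rewrite /ᵗ-≡-*inv c m | /ᵗ-≡-*inv F m | /ᵗ-≡-*inv m N | /ᵗ-≡-*inv R ρ | /ᵗ-≡-*inv R N | /ᵗ-≡-*inv (c + F) ρ
  = trans (factor-m C D c F R (inv N) (inv ρ) m (inv m)) (cong (C +_) (*-unitʳ (*-inv m≢0) _))
  where
  factor-m : ∀ C D c F R iN iρ m im →
    (C + (c * im) * (D * ((m * iN) * (R * iρ)))) + (D * ((m * iN) * (R * iρ))) * (F * im)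
    ≡ C + (D * (R * iN) * ((c + F) * iρ)) * (m * im)
  factor-m = solve-∀ ℚ-ring

sei-average : ∀ C D R M F N → R ≢ 0ℚ → M ≢ 0ℚ →
  C * (inv R * inv M) * (M * R) + D * (R /ᵗ N) * (inv R * inv M) * (M * F) ≡ C + D * (F /ᵗ N)
sei-average C D R M F N R≢0 M≢0
  rewrite /ᵗ-≡-*inv R N | /ᵗ-≡-*inv F N
  = trans (factor-units C D R (inv R) M (inv M) (inv N) F)
          (*-unitʳ (trans (cong₂ _*_ (*-inv R≢0) (*-inv M≢0)) (ℚ.*-identityˡ 1ℚ)) _)
  where
  factor-units : ∀ C D R iR M iM iN F →
    C * (iR * iM) * (M * R) + D * (R * iN) * (iR * iM) * (M * F) ≡ (C + D * (F * iN)) * ((R * iR) * (M * iM))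
  factor-units = solve-∀ ℚ-ring

forestCost-++ : ∀ xs ys → forestCost (xs ++ ys) ≡ forestCost xs + forestCost ys
forestCost-++ []       ys = sym (ℚ.+-identityˡ _)
forestCost-++ (x ∷ xs) ys =
  trans (cong (treeCost x +_) (forestCost-++ xs ys)) (sym (ℚ.+-assoc (treeCost x) _ _))

forestCost-∑ : ∀ xs → forestCost xs ≡ ∑ xs treeCost
forestCost-∑ []       = refl
forestCost-∑ (x ∷ xs) = cong (treeCost x +_) (forestCost-∑ xs)

forestCost-childrenS : ∀ xs → forestCost xs ≡ cS xs + forestCost (childrenS xs)
forestCost-childrenS []                 = sym (ℚ.+-identityˡ 0ℚ)
forestCost-childrenS (node c _ ts ∷ xs) = begin
  (c + forestCost ts) + forestCost xs
    ≡⟨ cong (c + forestCost ts +_) (forestCost-childrenS xs) ⟩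
  (c + forestCost ts) + (cS xs + forestCost (childrenS xs))
    ≡⟨ +-interchange c _ _ _ ⟩
  (c + cS xs) + (forestCost ts + forestCost (childrenS xs))
    ≡⟨ cong (c + cS xs +_) (forestCost-++ ts (childrenS xs)) ⟨
  (c + cS xs) + forestCost (ts ++ childrenS xs) ∎
  where open ≡-Reasoning

data PositiveImp : Tree → Set where
  node : ∀ {c r ts} → 0ℚ < r → All PositiveImp ts → PositiveImp (node c r ts)

PositiveImp⇒imp>0 : ∀ {t} → PositiveImp t → 0ℚ < imp t
PositiveImp⇒imp>0 (node r>0 _) = r>0

Admissible : ℕ → Tree → Set
Admissible f t = PositiveImp t × height t ≤ f

All-height≤ : ∀ ts {f} → heightF ts ≤ f → All (λ t → height t ≤ f) ts
All-height≤ []       _   = []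
All-height≤ (t ∷ ts) h≤f =
  ℕ.m⊔n≤o⇒m≤o (height t) _ h≤f ∷ All-height≤ ts (ℕ.m⊔n≤o⇒n≤o (height t) _ h≤f)

All-Admissible-childrenS : ∀ {f} xs → All (Admissible (suc f)) xs → All (Admissible f) (childrenS xs)
All-Admissible-childrenS []                 []                                = []
All-Admissible-childrenS (node _ _ ts ∷ xs) ((node _ pos-ts , s≤s h≤f) ∷ adm) =
  All.++⁺ (All.zip (pos-ts , All-height≤ ts h≤f)) (All-Admissible-childrenS xs adm)

module _ (B : ℕ) where

  mutual
    𝔼-seiRun : ∀ f x D C → All (Admissible f) x →
      𝔼 (seiRun B f x D C) ≡ C + D * (forestCost (childrenS x) /ᵗ ℕ→ℚ (length x))
    𝔼-seiRun zero    []               D C []             = trans (𝔼-dirac C) (sym (c+d*[0/q]≡c C D 0ℚ))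
    𝔼-seiRun zero    (node _ _ _ ∷ _) D C ((_ , ()) ∷ _)
    𝔼-seiRun (suc f) x                D C adm            =
      𝔼-seiStep f x (childrenS x) D C (All-Admissible-childrenS x adm)

    𝔼-seiStep : ∀ f x S D C → All (Admissible f) S →
      𝔼 (seiStep B f x S D C) ≡ C + D * (forestCost S /ᵗ ℕ→ℚ (length x))
    𝔼-seiStep f x []         D C _   = trans (𝔼-dirac C) (sym (c+d*[0/q]≡c C D (ℕ→ℚ (length x))))
    𝔼-seiStep f x S@(_ ∷ ss) D C adm = begin
      𝔼 (seiStep B f x S D C)
        ≡⟨ unfold ⟩
      ∑[ p ∈ picks S ] ∑[ w ∈ combs k (proj₂ p) ] weight p * 𝔼 (next (proj₁ p ∷ w))
        ≡⟨ ∑-congᴬ (All.map (∑-congᴬ ∘ summands) (picks-↭ S)) ⟩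
      ∑[ p ∈ picks S ] ∑[ w ∈ combs k (proj₂ p) ]
        (C * u * imp (proj₁ p) + K * u * (imp (proj₁ p) * ratio (proj₁ p ∷ w)))
        ≡⟨ trans (∑-cong (picks S) (λ p → ∑-linear (combs k (proj₂ p)) (C * u) (K * u) _ _))
                 (∑-linear (picks S) (C * u) (K * u) _ _) ⟩
      C * u * (∑[ p ∈ picks S ] ∑[ w ∈ combs k (proj₂ p) ] imp (proj₁ p))
        + K * u * (∑[ p ∈ picks S ] ∑[ w ∈ combs k (proj₂ p) ] imp (proj₁ p) * ratio (proj₁ p ∷ w))
        ≡⟨ cong₂ (λ a b → C * u * a + K * u * b)
                 (∑-picks-combs-head k S imp) (∑-picks-combs-ratio k S treeCost imp imp>0) ⟩
      C * u * (M * R) + K * u * (M * ∑ S treeCost)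
        ≡⟨ sei-average C D R M (∑ S treeCost) N R≢0 M≢0 ⟩
      C + D * (∑ S treeCost /ᵗ N)
        ≡⟨ cong (λ z → C + D * (z /ᵗ N)) (forestCost-∑ S) ⟨
      C + D * (forestCost S /ᵗ N) ∎
      where
      open ≡-Reasoning
      N = ℕ→ℚ (length x)
      R = rS S
      k = B ⊓ length S ∸ 1
      M = ℕ→ℚ (length ss choose k)
      u = inv R * inv M
      K = D * (R /ᵗ N)
      imp>0 : All (λ t → 0ℚ < imp t) S
      imp>0 = All.map (PositiveImp⇒imp>0 ∘ proj₁) adm
      ratio : List Tree → ℚ
      ratio X = ∑ X treeCost /ᵗ rS X
      D′ : List Tree → ℚ
      D′ X = D * ((ℕ→ℚ (length X) /ᵗ N) * (R /ᵗ rS X))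
      next : List Tree → Dist ℚ
      next X = seiRun B f X (D′ X) (C + (cS X /ᵗ ℕ→ℚ (length X)) * D′ X)
      weight : Tree × List Tree → ℚ
      weight p = (imp (proj₁ p) /ᵗ R) * inv (ℕ→ℚ (length (combs k (proj₂ p))))

      unfold : 𝔼 (seiStep B f x S D C)
             ≡ ∑[ p ∈ picks S ] ∑[ w ∈ combs k (proj₂ p) ] weight p * 𝔼 (next (proj₁ p ∷ w))
      unfold = trans (𝔼-concatMap branch (picks S)) (∑-cong (picks S) λ p →
        trans (𝔼-concatMap (scaled p) (combs k (proj₂ p)))
              (∑-cong (combs k (proj₂ p)) λ w → 𝔼-scale (weight p) (next (proj₁ p ∷ w))))
        where
        scaled : Tree × List Tree → List Tree → Dist ℚ
        scaled p w = scale (weight p) (next (proj₁ p ∷ w))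
        branch : Tree × List Tree → Dist ℚ
        branch p = concatMap (scaled p) (combs k (proj₂ p))

      summand : ∀ {y rest w} → y ∷ rest ↭ S → All (Admissible f) (y ∷ w) →
        weight (y , rest) * 𝔼 (next (y ∷ w)) ≡ C * u * imp y + K * u * (imp y * ratio (y ∷ w))
      summand {y} {rest} {w} ↭S adm-X = begin
        weight (y , rest) * 𝔼 (next X)
          ≡⟨ cong (weight (y , rest) *_) (𝔼-seiRun f X (D′ X) _ adm-X) ⟩
        weight (y , rest) * ((C + (cS X /ᵗ m) * D′ X) + D′ X * (forestCost (childrenS X) /ᵗ m))
          ≡⟨ cong (weight (y , rest) *_) (sei-update C D (cS X) (forestCost (childrenS X)) R (rS X) N m≢0) ⟩
        weight (y , rest) * (C + K * ((cS X + forestCost (childrenS X)) /ᵗ rS X))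
          ≡⟨ cong (λ z → weight (y , rest) * (C + K * (z /ᵗ rS X)))
                  (trans (sym (forestCost-childrenS X)) (forestCost-∑ X)) ⟩
        weight (y , rest) * (C + K * ratio X)
          ≡⟨ cong (_* (C + K * ratio X)) weight≡ ⟩
        imp y * u * (C + K * ratio X)
          ≡⟨ distribute (imp y) u C K (ratio X) ⟩
        C * u * imp y + K * u * (imp y * ratio X) ∎
        where
        X = y ∷ w
        m = ℕ→ℚ (length X)
        m≢0 : m ≢ 0ℚ
        m≢0 = >0⇒≢0 (ℕ→ℚ-suc-pos (length w))
        weight≡ : weight (y , rest) ≡ imp y * u
        weight≡ = begin
          (imp y /ᵗ R) * inv (ℕ→ℚ (length (combs k rest)))
            ≡⟨ cong₂ _*_ (/ᵗ-≡-*inv (imp y) R) (cong (inv ∘ ℕ→ℚ) (length-combs-remainder k ↭S)) ⟩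
          imp y * inv R * inv M
            ≡⟨ ℚ.*-assoc (imp y) (inv R) (inv M) ⟩
          imp y * u ∎
        distribute : ∀ h u C K φ → h * u * (C + K * φ) ≡ C * u * h + K * u * (h * φ)
        distribute = solve-∀ ℚ-ring

      summands : ∀ {p} → proj₁ p ∷ proj₂ p ↭ S →
        All (λ w → weight p * 𝔼 (next (proj₁ p ∷ w))
                   ≡ C * u * imp (proj₁ p) + K * u * (imp (proj₁ p) * ratio (proj₁ p ∷ w)))
            (combs k (proj₂ p))
      summands {y , rest} ↭S =
        All.map (λ adm-w → summand ↭S (All.head adm-y∷rest ∷ adm-w)) (All-combs k (All.tail adm-y∷rest))
        where adm-y∷rest = All-resp-↭ (↭-sym ↭S) adm

      R≢0 : R ≢ 0ℚ
      R≢0 = >0⇒≢0 (∑-pos imp>0)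
      M≢0 : M ≢ 0ℚ
      M≢0 = ℕ→ℚ-≢0 (k≤n⇒0<nCk (ℕ.∸-monoˡ-≤ 1 (ℕ.m⊓n≤n B (length S))))

  𝔼-SEI : ∀ vs → All PositiveImp vs → 𝔼 (SEI B vs) ≡ forestCost vs /ᵗ ℕ→ℚ (length vs)
  𝔼-SEI vs pos = begin
    𝔼 (SEI B vs)
      ≡⟨ 𝔼-seiRun (heightF vs) vs 1ℚ _ (All.zip (pos , All-height≤ vs ℕ.≤-refl)) ⟩
    cS vs /ᵗ N + 1ℚ * (forestCost (childrenS vs) /ᵗ N)
      ≡⟨ cong₂ (λ a b → a + 1ℚ * b) (/ᵗ-≡-*inv (cS vs) N) (/ᵗ-≡-*inv _ N) ⟩
    cS vs * inv N + 1ℚ * (forestCost (childrenS vs) * inv N)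
      ≡⟨ collect (cS vs) _ (inv N) ⟩
    (cS vs + forestCost (childrenS vs)) * inv N
      ≡⟨ cong (_* inv N) (forestCost-childrenS vs) ⟨
    forestCost vs * inv N
      ≡⟨ /ᵗ-≡-*inv (forestCost vs) N ⟨
    forestCost vs /ᵗ N ∎
    where
    open ≡-Reasoning
    N = ℕ→ℚ (length vs)
    collect : ∀ a b i → a * i + 1ℚ * (b * i) ≡ (a + b) * i
    collect = solve-∀ ℚ-ring

At-++ : ∀ {T p u q w} → At T p u → At u q w → At T (p ++ q) w
At-++ here        b = b
At-++ (there i a) b = there i (At-++ a b)

mutual
  positiveImp : ∀ u → (∀ {q w} → At u q w → 0ℚ < imp w) → PositiveImp u
  positiveImp (node _ _ ts) pos = node (pos here) (positiveImps ts (λ i a → pos (there i a)))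

  positiveImps : ∀ ts → (∀ (i : Fin (length ts)) {q w} → At (List.lookup ts i) q w → 0ℚ < imp w) →
                 All PositiveImp ts
  positiveImps []       _   = []
  positiveImps (t ∷ ts) pos = positiveImp t (pos Fin.zero) ∷ positiveImps ts (λ i → pos (Fin.suc i))

All-PositiveImp : ∀ {T v vs} → WellLabelled T → Pointwise (At T) v vs → All PositiveImp vs
All-PositiveImp wl []                   = []
All-PositiveImp wl (_∷_ {y = u} at ats) =
  positiveImp u (λ a → proj₂ (wl _ _ (At-++ at a))) ∷ All-PositiveImp wl ats

theorem3 : (B : ℕ) → 1 ≤ B → (T : Tree) → WellLabelled T →
           (v : List (List ℕ)) → v ≢ [] → Unique v →
           (d : ℕ) → All (λ p → length p ≡ d) v →
           (vs : List Tree) → Pointwise (At T) v vs →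
           𝔼 (SEI B vs) ≡ forestCost vs /ᵗ ℕ→ℚ (length v)
theorem3 B _ _ wl v _ _ _ _ vs at = begin
  𝔼 (SEI B vs)                      ≡⟨ 𝔼-SEI B vs (All-PositiveImp wl at) ⟩
  forestCost vs /ᵗ ℕ→ℚ (length vs)  ≡⟨ cong (λ n → forestCost vs /ᵗ ℕ→ℚ n) (Pointwise-length at) ⟨
  forestCost vs /ᵗ ℕ→ℚ (length v)   ∎
  where open ≡-Reasoning
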